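{- Let $S\subseteq\{1,\ldots,n\}^2$ contain no three points $a,b,c$ forming a $\Gamma$-configuration. Then $|S|\le 2n$.
   Context: Three points $a=(x_0,y_0)$, $b=(x_0,y_1)$, $c=(x_1,y_1)$ form a $\Gamma$-configuration if $y_0<y_1$ and $x_0<x_1$. -}

module Defs where

open import Data.Nat using (ℕ)
open import Data.Bool using (Bool; true; false; if_then_else_)
open import Data.Fin using (Fin; _<_)
open import Data.List using (List; map; allFin)
open import Data.Nat.ListAction using (sum)
open import Data.Product using (_×_)
open import Relation.Binary.PropositionalEquality using (_≡_)
open import Data.Empty using (⊥)

-- A set S ⊆ {1..n}², encoded by its characteristic function on Fin n × Fin n
-- (coordinate i : Fin n stands for the integer i+1).
PointSet : ℕ → Set
PointSet n = Fin n → Fin n → Bool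

_∈ₚ_ : ∀ {n} → Fin n × Fin n → PointSet n → Set
(x Data.Product., y) ∈ₚ S = S x y ≡ true

card : ∀ {n} → PointSet n → ℕ
card {n} S = sum (map (λ x → sum (map (λ y → if S x y then 1 else 0) (allFin n))) (allFin n))

ΓConfig : ∀ {n} → Fin n × Fin n → Fin n × Fin n → Fin n × Fin n → Set
ΓConfig (x₀ Data.Product., y₀) (x₀' Data.Product., y₁) (x₁ Data.Product., y₁') =
  (x₀' ≡ x₀) × (y₁' ≡ y₁) × (y₀ < y₁) × (x₀ < x₁)

ΓFree : ∀ {n} → PointSet n → Set
ΓFree S = ∀ a b c → a ∈ₚ S → b ∈ₚ S → c ∈ₚ S → ΓConfig a b c → ⊥

module Submission where

-- Every point (x , y) of a Γ-free set S is either the lowest point of S in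
-- its column x or the rightmost point of S in its row y: otherwise some
-- (x , y') ∈ S with y' < y and some (x' , y) ∈ S with x < x' would form a
-- Γ-configuration together with (x , y).  A column has at most one lowest
-- point and a row at most one rightmost point, so there are at most n
-- points of the first kind and at most n of the second, whence |S| ≤ 2n.

open import Defs
open import Data.Nat using (ℕ; zero; suc; _+_; _*_; _≤_; z≤n; s≤s)
open import Data.Nat.Properties
  using (≤-refl; ≤-reflexive; ≤-trans; m≤m+n; +-mono-≤; *-distribˡ-+; *-comm; +-0-commutativeMonoid; module ≤-Reasoning)
open import Data.Nat.ListAction using () renaming (sum to listSum)
open import Data.Bool using (Bool; true; false; if_then_else_)
open import Data.Bool.Properties using () renaming (_≟_ to _≟ᵇ_)
open import Data.Fin using (Fin; _<_) renaming (zero to fzero; suc to fsuc)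
open import Data.Fin.Properties using (any?; <-cmp; _<?_; suc-injective; 0≢1+n)
open import Data.List using (map; allFin; tabulate)
open import Data.List.Properties using (map-tabulate)
open import Data.Product using (_×_; _,_; ∃)
open import Data.Sum using (_⊎_; inj₁; inj₂; [_,_])
open import Data.Empty using (⊥-elim)
open import Function using (_∘_; id)
open import Relation.Nullary using (Dec; yes; no; does; ¬_; ¬?; contradiction)
open import Relation.Nullary.Decidable using (_×-dec_)
open import Relation.Unary using (Pred; Decidable)
open import Level using (Level; 0ℓ)
open import Relation.Binary using (tri<; tri≈; tri>)
open import Relation.Binary.PropositionalEquality using (_≡_; refl; cong; trans; module ≡-Reasoning)
open import Algebra.Properties.CommutativeMonoid.Sum +-0-commutativeMonoid
  using (sum-syntax; ∑-distrib-+; ∑-comm; sum-cong-≗)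

private variable ℓ : Level

ind : Bool → ℕ
ind b = if b then 1 else 0

ind≤1 : ∀ b → ind b ≤ 1
ind≤1 true  = ≤-refl
ind≤1 false = z≤n

listSum-tabulate : ∀ {n} (f : Fin n → ℕ) → listSum (tabulate f) ≡ ∑[ i < n ] f i
listSum-tabulate {n = zero}  f = refl
listSum-tabulate {n = suc n} f = cong (f fzero +_) (listSum-tabulate (f ∘ fsuc))

listSum-allFin : ∀ {n} (f : Fin n → ℕ) → listSum (map f (allFin n)) ≡ ∑[ i < n ] f i
listSum-allFin f = trans (cong listSum (map-tabulate id f)) (listSum-tabulate f)

∑-mono-≤ : ∀ {n} {f g : Fin n → ℕ} → (∀ i → f i ≤ g i) → ∑[ i < n ] f i ≤ ∑[ i < n ] g i
∑-mono-≤ {n = zero}  f≤g = z≤n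
∑-mono-≤ {n = suc n} f≤g = +-mono-≤ (f≤g fzero) (∑-mono-≤ (f≤g ∘ fsuc))

∑∑-split : ∀ {m n} (f g : Fin m → Fin n → ℕ) →
           ∑[ i < m ] ∑[ j < n ] (f i j + g i j)
         ≡ ∑[ i < m ] ∑[ j < n ] f i j + ∑[ j < n ] ∑[ i < m ] g i j
∑∑-split {m} {n} f g = begin
  ∑[ i < m ] ∑[ j < n ] (f i j + g i j)                        ≡⟨ sum-cong-≗ (λ i → ∑-distrib-+ (f i) (g i)) ⟩
  ∑[ i < m ] (∑[ j < n ] f i j + ∑[ j < n ] g i j)             ≡⟨ ∑-distrib-+ (λ i → ∑[ j < n ] f i j) (λ i → ∑[ j < n ] g i j) ⟩
  ∑[ i < m ] ∑[ j < n ] f i j + ∑[ i < m ] ∑[ j < n ] g i j    ≡⟨ cong (∑[ i < m ] ∑[ j < n ] f i j +_) (∑-comm g) ⟩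
  ∑[ i < m ] ∑[ j < n ] f i j + ∑[ j < n ] ∑[ i < m ] g i j    ∎
  where open ≡-Reasoning

∑-bounded : ∀ {n k} (f : Fin n → ℕ) → (∀ i → f i ≤ k) → ∑[ i < n ] f i ≤ n * k
∑-bounded {n = zero}  f f≤k = z≤n
∑-bounded {n = suc n} f f≤k = +-mono-≤ (f≤k fzero) (∑-bounded (f ∘ fsuc) (f≤k ∘ fsuc))

count : ∀ {n} {P : Pred (Fin n) ℓ} → Decidable P → ℕ
count {n = n} P? = ∑[ i < n ] ind (does (P? i))

count-none : ∀ {n} {P : Pred (Fin n) ℓ} (P? : Decidable P) → (∀ i → ¬ P i) → count P? ≡ 0
count-none {n = zero}  P? none = refl
count-none {n = suc n} P? none with P? fzero
... | yes p = contradiction p (none fzero)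
... | no  _ = count-none (P? ∘ fsuc) (none ∘ fsuc)

count-unique : ∀ {n} {P : Pred (Fin n) ℓ} (P? : Decidable P) →
               (∀ i j → P i → P j → i ≡ j) → count P? ≤ 1
count-unique {n = zero}  P? unique = z≤n
count-unique {n = suc n} P? unique with P? fzero
... | yes p = s≤s (≤-reflexive (count-none (P? ∘ fsuc) λ i q → 0≢1+n (unique _ _ p q)))
... | no  _ = count-unique (P? ∘ fsuc) λ i j p q → suc-injective (unique _ _ p q)

ind≤ind+ind : ∀ {a b} {A : Set a} {B : Set b} (t : Bool) (A? : Dec A) (B? : Dec B) →
              (t ≡ true → A ⊎ B) → ind t ≤ ind (does A?) + ind (does B?)
ind≤ind+ind t     (yes _) _       _    = ≤-trans (ind≤1 t) (m≤m+n 1 _)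
ind≤ind+ind t     (no _)  (yes _) _    = ind≤1 t
ind≤ind+ind false (no _)  (no _)  _    = z≤n
ind≤ind+ind true  (no ¬a) (no ¬b) a⊎b = ⊥-elim ([ ¬a , ¬b ] (a⊎b refl))

Least : ∀ {n} → Pred (Fin n) ℓ → Pred (Fin n) ℓ
Least Q i = Q i × ¬ (∃ λ j → j < i × Q j)

Greatest : ∀ {n} → Pred (Fin n) ℓ → Pred (Fin n) ℓ
Greatest Q i = Q i × ¬ (∃ λ j → i < j × Q j)

least? : ∀ {n} {Q : Pred (Fin n) ℓ} → Decidable Q → Decidable (Least Q)
least? Q? i = Q? i ×-dec ¬? (any? λ j → (j <? i) ×-dec Q? j)

greatest? : ∀ {n} {Q : Pred (Fin n) ℓ} → Decidable Q → Decidable (Greatest Q)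
greatest? Q? i = Q? i ×-dec ¬? (any? λ j → (i <? j) ×-dec Q? j)

least-unique : ∀ {n} {Q : Pred (Fin n) ℓ} i j → Least Q i → Least Q j → i ≡ j
least-unique i j (qi , ¬below-i) (qj , ¬below-j) with <-cmp i j
... | tri< i<j _ _ = contradiction (i , i<j , qi) ¬below-j
... | tri≈ _ i≡j _ = i≡j
... | tri> _ _ j<i = contradiction (j , j<i , qj) ¬below-i

greatest-unique : ∀ {n} {Q : Pred (Fin n) ℓ} i j → Greatest Q i → Greatest Q j → i ≡ j
greatest-unique i j (qi , ¬above-i) (qj , ¬above-j) with <-cmp i j
... | tri< i<j _ _ = contradiction (j , i<j , qj) ¬above-i
... | tri≈ _ i≡j _ = i≡j
... | tri> _ _ j<i = contradiction (i , j<i , qi) ¬above-j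

module _ {n : ℕ} (S : PointSet n) where

  InColumn : Fin n → Pred (Fin n) 0ℓ
  InColumn x y = S x y ≡ true

  InRow : Fin n → Pred (Fin n) 0ℓ
  InRow y x = S x y ≡ true

  lowest? : ∀ x → Decidable (Least (InColumn x))
  lowest? x = least? λ y → S x y ≟ᵇ true

  rightmost? : ∀ y → Decidable (Greatest (InRow y))
  rightmost? y = greatest? λ x → S x y ≟ᵇ true

  lowest-or-rightmost : ΓFree S → ∀ x y → S x y ≡ true →
                        Least (InColumn x) y ⊎ Greatest (InRow y) x
  lowest-or-rightmost free x y xy∈S
    with any? (λ y' → (y' <? y) ×-dec (S x y' ≟ᵇ true))
       | any? (λ x' → (x <? x') ×-dec (S x' y ≟ᵇ true))
  ... | no ¬below | _ = inj₁ (xy∈S , ¬below)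
  ... | yes _ | no ¬right = inj₂ (xy∈S , ¬right)
  ... | yes (y' , y'<y , xy'∈S) | yes (x' , x<x' , x'y∈S) =
    ⊥-elim (free (x , y') (x , y) (x' , y) xy'∈S xy∈S x'y∈S (refl , refl , y'<y , x<x'))

  ind≤lowest+rightmost : ΓFree S → ∀ x y →
    ind (S x y) ≤ ind (does (lowest? x y)) + ind (does (rightmost? y x))
  ind≤lowest+rightmost free x y =
    ind≤ind+ind (S x y) (lowest? x y) (rightmost? y x) (lowest-or-rightmost free x y)

card≡∑∑ : ∀ n (S : PointSet n) → card S ≡ ∑[ x < n ] ∑[ y < n ] ind (S x y)
card≡∑∑ n S =
  trans (listSum-allFin (λ x → listSum (map (λ y → ind (S x y)) (allFin n))))
        (sum-cong-≗ λ x → listSum-allFin λ y → ind (S x y))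

lemma7 : (n : ℕ) (S : PointSet n) → ΓFree S → card S ≤ 2 * n
lemma7 n S free = begin
  card S                                              ≡⟨ card≡∑∑ n S ⟩
  ∑[ x < n ] ∑[ y < n ] ind (S x y)                   ≤⟨ ∑-mono-≤ (λ x → ∑-mono-≤ (ind≤lowest+rightmost S free x)) ⟩
  ∑[ x < n ] ∑[ y < n ] (lowest x y + rightmost x y)  ≡⟨ ∑∑-split lowest rightmost ⟩
  ∑[ x < n ] count (lowest? S x) + ∑[ y < n ] count (rightmost? S y)
    ≤⟨ +-mono-≤ (∑-bounded _ λ x → count-unique (lowest? S x) least-unique)
                (∑-bounded _ λ y → count-unique (rightmost? S y) greatest-unique) ⟩
  n * 1 + n * 1                                       ≡⟨ *-distribˡ-+ n 1 1 ⟨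
  n * 2                                               ≡⟨ *-comm n 2 ⟩
  2 * n                                               ∎
  where
  open ≤-Reasoning
  lowest rightmost : Fin n → Fin n → ℕ
  lowest    x y = ind (does (lowest? S x y))
  rightmost x y = ind (does (rightmost? S y x))
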